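{- Let $P$ be a GPEA, and let $U$ be its $\gamma$-unitization. Then $P$ is a normal Riesz ideal in $U$ iff $P$ is upward directed.
   Context: $P$ is a GPEA (partial operation $\oplus$, constant $0$; partial associativity; conjugation: if $a\oplus b$ exists there are $c,d$ with $a\oplus b=c\oplus a=b\oplus d$; two-sided cancellation; $0$ neutral; positivity). Order: $a\le b$ iff $a\oplus c=b$ for some $c$; for $a\le b$, $a/b$ is the unique $c$ with $a\oplus c=b$ and $b\backslash a$ the unique $d$ with $d\oplus a=b$. $\gamma$ is a unitizing GPEA-automorphism of $P$: a GPEA-automorphism with $\gamma a\oplus b$ defined iff $b\oplus a$ defined. The $\gamma$-unitization: $U=P\cup P^\eta$ with $\eta\colon P\to P^\eta$ a bijection onto a disjoint set, $1:=\eta0$, and $+$: sums within $P$ as in $P$; $a+\eta b$ defined iff $a\le b$, equal to $\eta(b\backslash a)$; $\eta a+b$ defined iff $\gamma b\le a$, equal to $\eta(\gamma b/a)$; no sums of two elements of $P^\eta$. $U$ is a pseudo effect algebra (GPEA with top $1$) with $\eta a=a^\sim$, $\gamma a=a^{ -- }$. In a GPEA, an ideal is a nonempty down-set closed under existing sums; normal iff $a\oplus c=c\oplus b$ implies ($a\in I\Leftrightarrow b\in I$). (R1): if $i\in I$, $a\oplus b$ exists, $i\le a\oplus b$, then there are $j,k\in I$, $j\le a$, $k\le b$, $i\le j\oplus k$. A Riesz ideal is an R1-ideal satisfying (R2): if $i\in I$, $i\le a$, then (i) if $(a\backslash i)\oplus b$ exists there is $j\in I$, $j\le b$, with $a\oplus(j/b)$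 existing, and (ii) if $b\oplus(i/a)$ exists there is $k\in I$, $k\le b$, with $(b\backslash k)\oplus a$ existing. Upward directed: any two elements have a common upper bound. -}

module Defs where

open import Data.Product using (Σ; ∃; ∃-syntax; _×_; _,_)
open import Data.Sum using (_⊎_; inj₁; inj₂)
open import Data.Empty using (⊥)
open import Data.Unit using (⊤)
open import Relation.Binary.PropositionalEquality using (_≡_)

-- Partial binary operations are represented by their graph:
--   Sum a b c   means   "a ⊕ b is defined and equals c".

module PartialOps {A : Set} (Sum : A → A → A → Set) where

  _≤_ : A → A → Set
  a ≤ b = ∃[ c ] Sum a c b

  Defined : A → A → Set
  Defined a b = ∃[ c ] Sum a b c

  IsIdeal : (A → Set) → Set
  IsIdeal I =
      (∃[ a ] I a)
    × (∀ {a b} → I b → a ≤ b → I a)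
    × (∀ {a b c} → I a → I b → Sum a b c → I c)

  NormalCond : (A → Set) → Set
  NormalCond I = ∀ {a b c s} → Sum a c s → Sum c b s → (I a → I b) × (I b → I a)

  R1 : (A → Set) → Set
  R1 I = ∀ {i a b s} → I i → Sum a b s → i ≤ s →
           ∃[ j ] ∃[ k ] (I j × I k × j ≤ a × k ≤ b × ∃[ t ] (Sum j k t × i ≤ t))

  -- (R2)(i): i ∈ I, i ≤ a, d = a \ i (i.e. d ⊕ i = a), d ⊕ b exists
  --   ⇒ ∃ j ∈ I, j ≤ b, with a ⊕ (j / b) existing  (c = j / b, i.e. j ⊕ c = b)
  R2i : (A → Set) → Set
  R2i I = ∀ {i a b d} → I i → i ≤ a → Sum d i a → Defined d b →
            ∃[ j ] (I j × ∃[ c ] (Sum j c b × Defined a c))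

  -- (R2)(ii): i ∈ I, i ≤ a, f = i / a (i.e. i ⊕ f = a), b ⊕ f exists
  --   ⇒ ∃ k ∈ I, k ≤ b, with (b \ k) ⊕ a existing  (g = b \ k, i.e. g ⊕ k = b)
  R2ii : (A → Set) → Set
  R2ii I = ∀ {i a b f} → I i → i ≤ a → Sum i f a → Defined b f →
             ∃[ k ] (I k × ∃[ g ] (Sum g k b × Defined g a))

  IsR1Ideal : (A → Set) → Set
  IsR1Ideal I = IsIdeal I × R1 I

  IsRieszIdeal : (A → Set) → Set
  IsRieszIdeal I = IsR1Ideal I × R2i I × R2ii I

  IsNormalRieszIdeal : (A → Set) → Set
  IsNormalRieszIdeal I = IsRieszIdeal I × NormalCond I

  UpwardDirected : Set
  UpwardDirected = ∀ a b → ∃[ c ] (a ≤ c × b ≤ c)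

record GPEA : Set₁ where
  field
    Carrier : Set
    Sum     : Carrier → Carrier → Carrier → Set
    𝟘       : Carrier
    functional : ∀ {a b c c'} → Sum a b c → Sum a b c' → c ≡ c'
    assocˡ : ∀ {a b c d e} → Sum a b d → Sum d c e →
               ∃[ f ] (Sum b c f × Sum a f e)
    assocʳ : ∀ {a b c f e} → Sum b c f → Sum a f e →
               ∃[ d ] (Sum a b d × Sum d c e)
    conjugation : ∀ {a b s} → Sum a b s →
                    (∃[ c ] Sum c a s) × (∃[ d ] Sum b d s)
    cancelˡ : ∀ {a b c s} → Sum a b s → Sum a c s → b ≡ c
    cancelʳ : ∀ {a b c s} → Sum b a s → Sum c a s → b ≡ c
    neutralʳ : ∀ a → Sum a 𝟘 a
    neutralˡ : ∀ a → Sum 𝟘 a a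
    positive : ∀ {a b} → Sum a b 𝟘 → (a ≡ 𝟘) × (b ≡ 𝟘)

  open PartialOps Sum public

record UnitizingAut (P : GPEA) : Set where
  open GPEA P
  field
    γ    : Carrier → Carrier
    γ⁻¹  : Carrier → Carrier
    γ∘γ⁻¹ : ∀ a → γ (γ⁻¹ a) ≡ a
    γ⁻¹∘γ : ∀ a → γ⁻¹ (γ a) ≡ a
    γ-pres   : ∀ {a b c} → Sum a b c → Sum (γ a) (γ b) (γ c)
    γ-reflect : ∀ {a b c} → Sum (γ a) (γ b) (γ c) → Sum a b c
    unitizing-to   : ∀ {a b} → Defined (γ a) b → Defined b a
    unitizing-from : ∀ {a b} → Defined b a → Defined (γ a) b

-- The γ-unitization U = P ∪ P^η, with P ≅ inj₁ and η a = inj₂ a.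

module Unitization (P : GPEA) (Γ : UnitizingAut P) where
  open GPEA P
  open UnitizingAut Γ

  UCarrier : Set
  UCarrier = Carrier ⊎ Carrier

  η : Carrier → UCarrier
  η = inj₂

  𝟙 : UCarrier
  𝟙 = η 𝟘

  USum : UCarrier → UCarrier → UCarrier → Set
  USum (inj₁ a) (inj₁ b) (inj₁ c) = Sum a b c
  -- a + η b defined iff a ≤ b, equal to η (b \ a); i.e. a + η b = η d iff d ⊕ a = b
  USum (inj₁ a) (inj₂ b) (inj₂ d) = Sum d a b
  -- η a + b defined iff γ b ≤ a, equal to η (γ b / a); i.e. η a + b = η d iff γ b ⊕ d = a
  USum (inj₂ a) (inj₁ b) (inj₂ d) = Sum (γ b) d a
  USum _ _ _ = ⊥

  open PartialOps USum public
    renaming (_≤_ to _≤U_; Defined to DefinedU)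

  InP : UCarrier → Set
  InP (inj₁ _) = ⊤
  InP (inj₂ _) = ⊥

-- * Order facts in P: transitivity, monotonicity of j ↦ j ⊕ k, and the key
--   consequence of directedness, `commonExtension`: two right summands
--   x, y of one element d can be completed to a common element m = x ⊕ u =
--   y ⊕ v with d ⊕ m still defined.
-- * Facts about U: it has 0 as a two-sided unit; for p, a ∈ P we have
--   p ≤ η a in U iff a ⊕ p is defined in P; and the η-degree
--   (0 on P, 1 on P^η) is additive on sums.  Additivity of the degree
--   alone shows that P is an ideal of U and that it is normal.
-- * (⇒) Apply (R1) to i ≤ 1 = a + η a: it yields j ≤ a and k ≤ η a with
--   i ≤ j ⊕ k; then a ⊕ k is an upper bound of a and i.
-- * (⇐) (R1) and (R2) are checked by cases on which arguments lie in P^η;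
--   the non-trivial cases are instances of `commonExtension` and of the
--   existence of upper bounds.
module Submission where

open import Defs
open import Data.Nat using (ℕ; _+_)
open import Data.Nat.Properties using (+-comm; +-cancelʳ-≡; m+n≡0⇒m≡0)
open import Data.Product using (_×_; _,_; ∃-syntax; proj₁; proj₂)
open import Data.Sum using (inj₁; inj₂)
open import Data.Unit using (tt)
open import Relation.Binary.PropositionalEquality
  using (_≡_; refl; sym; trans; subst; cong₂; module ≡-Reasoning)

module GPEAFacts (P : GPEA) where
  open GPEA P

  ≤-trans : ∀ {a b c} → a ≤ b → b ≤ c → a ≤ c
  ≤-trans (e , sae) (f , sbf) =
    let (g , _ , sag) = assocˡ sae sbf in g , sag

  -- Adding k on the right is monotone: j ≤ a and a ⊕ k = c give j ⊕ k ≤ c.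
  -- (Write a = j ⊕ e and move e past k by conjugation.)
  ⊕-monoˡ : ∀ {j a k c t} → j ≤ a → Sum a k c → Sum j k t → t ≤ c
  ⊕-monoˡ {c = c} (e , sjea) sakc sjkt =
    let (f , sekf , sjfc) = assocˡ sjea sakc
        (e' , ske'f)      = proj₂ (conjugation sekf)
        (t' , sjkt' , st'e'c) = assocʳ ske'f sjfc
    in e' , subst (λ w → Sum w e' c) (functional sjkt' sjkt) st'e'c

  -- In a directed GPEA, if d ⊕ x = p and d ⊕ y both exist, there is an m
  -- with x ≤ m (m = x ⊕ u), y ≤ m and d ⊕ m = z = p ⊕ u defined:
  -- take z above p and d ⊕ y and cancel d.
  commonExtension : UpwardDirected → ∀ {d x y p q} → Sum d x p → Sum d y q →
    ∃[ m ] ∃[ u ] ∃[ v ] ∃[ z ] (Sum x u m × Sum y v m × Sum d m z × Sum p u z)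
  commonExtension ud sdxp sdyq =
    let (z , (u , spuz) , (v , sqvz)) = ud _ _
        (m , sxum , sdmz)   = assocˡ sdxp spuz
        (m' , syvm' , sdm'z) = assocˡ sdyq sqvz
        m'≡m = cancelˡ sdm'z sdmz
    in m , u , v , z , sxum , subst (Sum _ v) m'≡m syvm' , sdmz , spuz

module UnitizationFacts (P : GPEA) (Γ : UnitizingAut P) where
  open GPEA P hiding (IsIdeal; NormalCond; R1; R2i; R2ii)
  open UnitizingAut Γ
  open Unitization P Γ
    using (UCarrier; η; 𝟙; USum; InP; _≤U_; DefinedU; IsIdeal; NormalCond; R1; R2i; R2ii)
  open GPEAFacts P

  γ𝟘 : γ 𝟘 ≡ 𝟘
  γ𝟘 = cancelˡ (γ-pres (neutralʳ 𝟘)) (neutralʳ (γ 𝟘))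

  -- 0 ∈ P is a two-sided unit of U (η a + 0 = η (γ 0 / a) = η a).
  U-neutralʳ : ∀ x → USum x (inj₁ 𝟘) x
  U-neutralʳ (inj₁ a) = neutralʳ a
  U-neutralʳ (inj₂ a) = subst (λ w → Sum w a a) (sym γ𝟘) (neutralˡ a)

  U-neutralˡ : ∀ x → USum (inj₁ 𝟘) x x
  U-neutralˡ (inj₁ a) = neutralˡ a
  U-neutralˡ (inj₂ a) = neutralʳ a

  ≤U-refl : ∀ x → x ≤U x
  ≤U-refl x = inj₁ 𝟘 , U-neutralʳ x

  ≤U⇒≤ : ∀ {a b} → inj₁ a ≤U inj₁ b → a ≤ b
  ≤U⇒≤ (inj₁ c , sacb) = c , sacb

  ≤⇒≤U : ∀ {a b} → a ≤ b → inj₁ a ≤U inj₁ b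
  ≤⇒≤U (c , sacb) = inj₁ c , sacb

  -- For p, a ∈ P:  p ≤ η a in U  iff  a ⊕ p is defined (p + η(a ⊕ p) = η a).
  ≤η⇒Defined : ∀ {p a} → inj₁ p ≤U η a → Defined a p
  ≤η⇒Defined (inj₂ c , sapc) = c , sapc

  Defined⇒≤η : ∀ {p a} → Defined a p → inj₁ p ≤U η a
  Defined⇒≤η (c , sapc) = inj₂ c , sapc

  -- If η a + b = η d, then d ⊕ (x ⊕ b) defined forces a ⊕ x defined:
  -- (d ⊕ x) ⊕ b exists, so by unitization γ b ⊕ (d ⊕ x) = (γ b ⊕ d) ⊕ x does.
  shiftPastγ : ∀ {a b d x m} → Sum (γ b) d a → Sum x b m → Defined d m →
    Defined a x
  shiftPastγ {x = x} sγbda sxbm (z , sdmz) =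
    let (y , sdxy , sybz) = assocʳ sxbm sdmz
        (g , sγbyg)       = unitizing-from (z , sybz)
        (a' , sγbda' , sa'xg) = assocʳ sdxy sγbyg
    in g , subst (λ w → Sum w x g) (functional sγbda' sγbda) sa'xg

  deg : UCarrier → ℕ
  deg (inj₁ _) = 0
  deg (inj₂ _) = 1

  deg-sum : ∀ {x y s} → USum x y s → deg x + deg y ≡ deg s
  deg-sum {inj₁ _} {inj₁ _} {inj₁ _} _ = refl
  deg-sum {inj₁ _} {inj₂ _} {inj₂ _} _ = refl
  deg-sum {inj₂ _} {inj₁ _} {inj₂ _} _ = refl
  deg-sum {inj₁ _} {inj₁ _} {inj₂ _} ()
  deg-sum {inj₁ _} {inj₂ _} {inj₁ _} ()
  deg-sum {inj₂ _} {inj₁ _} {inj₁ _} ()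
  deg-sum {inj₂ _} {inj₂ _} {_}      ()

  InP⇒deg0 : ∀ {x} → InP x → deg x ≡ 0
  InP⇒deg0 {inj₁ _} _ = refl

  deg0⇒InP : ∀ {x} → deg x ≡ 0 → InP x
  deg0⇒InP {inj₁ _} _ = tt

  -- P is an ideal of U: degrees are additive and nonnegative.
  P-ideal : IsIdeal InP
  P-ideal = (inj₁ 𝟘 , tt) , downward , closed
    where
    downward : ∀ {a b} → InP b → a ≤U b → InP a
    downward {a} {b} p∈P (c , sacb) =
      deg0⇒InP (m+n≡0⇒m≡0 (deg a) (trans (deg-sum {a} {c} {b} sacb) (InP⇒deg0 p∈P)))

    closed : ∀ {a b c} → InP a → InP b → USum a b c → InP c
    closed {a} {b} {c} a∈P b∈P sabc =
      deg0⇒InP (trans (sym (deg-sum {a} {b} {c} sabc)) (cong₂ _+_ (InP⇒deg0 a∈P) (InP⇒deg0 b∈P)))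

  -- P is normal in U: a + c = c + b forces deg a = deg b.
  P-normal : NormalCond InP
  P-normal {a} {b} {c} {s} sacs scbs = transport degEq , transport (sym degEq)
    where
    degEq : deg a ≡ deg b
    degEq = +-cancelʳ-≡ (deg c) (deg a) (deg b) (begin
      deg a + deg c  ≡⟨ deg-sum {a} {c} {s} sacs ⟩
      deg s          ≡⟨ sym (deg-sum {c} {b} {s} scbs) ⟩
      deg c + deg b  ≡⟨ +-comm (deg c) (deg b) ⟩
      deg b + deg c  ∎)
      where open ≡-Reasoning

    transport : ∀ {x y} → deg x ≡ deg y → InP x → InP y
    transport eq x∈P = deg0⇒InP (trans (sym eq) (InP⇒deg0 x∈P))

  -- (⇒) (R1) for i ≤ 1 = a + η a yields an upper bound a ⊕ k of a and i.
  R1⇒directed : R1 InP → UpwardDirected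
  R1⇒directed r1 a i
    with r1 {inj₁ i} {inj₁ a} {η a} {𝟙} tt (neutralˡ a) (Defined⇒≤η (i , neutralˡ i))
  ... | inj₁ j , inj₁ k , _ , _ , j≤a , k≤ηa , inj₁ t , sjkt , i≤t =
    let (c , sakc) = ≤η⇒Defined k≤ηa
    in c , (k , sakc) , ≤-trans (≤U⇒≤ i≤t) (⊕-monoˡ (≤U⇒≤ j≤a) sakc sjkt)

  module Directed (ud : UpwardDirected) where

    P-R1 : R1 InP
    P-R1 {inj₁ i} {inj₁ a} {inj₁ b} {inj₁ s} _ sabs i≤s =
      inj₁ a , inj₁ b , tt , tt , ≤U-refl (inj₁ a) , ≤U-refl (inj₁ b) , inj₁ s , sabs , i≤s
    -- a + η b = η d (d ⊕ a = b) and d ⊕ i defined: extend a and i to m.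
    P-R1 {inj₁ i} {inj₁ a} {inj₂ b} {inj₂ d} _ sdab i≤ηd =
      let (m , u , v , z , saum , sivm , _ , sbuz) =
            commonExtension ud sdab (proj₂ (≤η⇒Defined i≤ηd))
      in inj₁ a , inj₁ u , tt , tt , ≤U-refl (inj₁ a) , Defined⇒≤η (z , sbuz) ,
         inj₁ m , saum , ≤⇒≤U (v , sivm)
    -- η a + b = η d (γ b ⊕ d = a) and d ⊕ i defined: extend b and i to
    -- m = b ⊕ u = x ⊕ b, and take j = x, k = b.
    P-R1 {inj₁ i} {inj₂ a} {inj₁ b} {inj₂ d} _ sγbda i≤ηd =
      let sdb = proj₂ (unitizing-to (a , sγbda))
          (m , u , v , z , sbum , sivm , sdmz , _) =
            commonExtension ud sdb (proj₂ (≤η⇒Defined i≤ηd))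
          (x , sxbm) = proj₁ (conjugation sbum)
      in inj₁ x , inj₁ b , tt , tt , Defined⇒≤η (shiftPastγ sγbda sxbm (z , sdmz)) ,
         ≤U-refl (inj₁ b) , inj₁ m , sxbm , ≤⇒≤U (v , sivm)

    -- η b = j + c with a + c defined: c = η z for an upper bound z of a, b.
    ηSplitRight : ∀ a b → ∃[ j ] ∃[ c ] (USum (inj₁ j) c (η b) × DefinedU (inj₁ a) c)
    ηSplitRight a b =
      let (z , (j , sbjz) , (_ , saqz)) = ud b a
          (y , syaz) = proj₁ (conjugation saqz)
      in j , η z , sbjz , (η y , syaz)

    -- η b = g + k with g + a defined: g = η z for an upper bound z of γ a, b.
    ηSplitLeft : ∀ a b → ∃[ k ] ∃[ g ] (USum g (inj₁ k) (η b) × DefinedU g (inj₁ a))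
    ηSplitLeft a b =
      let (z , (p , sγapz) , (_ , sbqz)) = ud (γ a) b
          (x , sxbz) = proj₁ (conjugation sbqz)
      in γ⁻¹ x , η z , subst (λ w → Sum w b z) (sym (γ∘γ⁻¹ x)) sxbz , (η p , sγapz)

    -- (R2)(i): for b ∈ P take j = b, c = 0; otherwise a ∈ P and split η b.
    P-R2i : R2i InP
    P-R2i {a = a} {b = inj₁ b} _ _ _ _ =
      inj₁ b , tt , inj₁ 𝟘 , neutralʳ b , (a , U-neutralʳ a)
    P-R2i {inj₁ i} {inj₁ a} {inj₂ b} {inj₁ d} _ _ _ _ =
      let (j , c , sjcb , ac) = ηSplitRight a b in inj₁ j , tt , c , sjcb , ac
    P-R2i {inj₁ i} {inj₂ a} {inj₂ b} {inj₂ d} _ _ _ (inj₁ _ , ())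
    P-R2i {inj₁ i} {inj₂ a} {inj₂ b} {inj₂ d} _ _ _ (inj₂ _ , ())

    -- (R2)(ii): for b ∈ P take k = b, g = 0; otherwise a ∈ P and split η b.
    P-R2ii : R2ii InP
    P-R2ii {a = a} {b = inj₁ b} _ _ _ _ =
      inj₁ b , tt , inj₁ 𝟘 , neutralˡ b , (a , U-neutralˡ a)
    P-R2ii {inj₁ i} {inj₁ a} {inj₂ b} {inj₁ f} _ _ _ _ =
      let (k , g , sgkb , ga) = ηSplitLeft a b in inj₁ k , tt , g , sgkb , ga
    P-R2ii {inj₁ i} {inj₂ a} {inj₂ b} {inj₂ f} _ _ _ (inj₁ _ , ())
    P-R2ii {inj₁ i} {inj₂ a} {inj₂ b} {inj₂ f} _ _ _ (inj₂ _ , ())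

theorem4p12 : (P : GPEA) (Γ : UnitizingAut P) →
    let open Unitization P Γ in
    (IsNormalRieszIdeal InP → GPEA.UpwardDirected P) × (GPEA.UpwardDirected P → IsNormalRieszIdeal InP)
theorem4p12 P Γ =
    (λ (((_ , r1) , _) , _) → R1⇒directed r1)
  , λ ud → let open Directed ud in
      -- the auxiliary element d (resp. f) of (R2) is not inferable from the
      -- sums it appears in, so the implicit arguments are passed on explicitly
      ( (P-ideal , P-R1)
      , (λ {i a b d} → P-R2i {i} {a} {b} {d})
      , (λ {i a b f} → P-R2ii {i} {a} {b} {f}))
      , P-normal
  where open UnitizationFacts P Γ
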